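{- For every $n$, the number of unipotent semisymmetric Latin squares of order $n$ is $n$ times the number of reduced semisymmetric Latin squares of order $n$. Moreover, the numbers of isomorphism classes, isotopism classes and species containing unipotent semisymmetric Latin squares of order $n$ are equal, respectively, to the numbers of isomorphism classes, isotopism classes and species containing reduced semisymmetric Latin squares of order $n$. All of these statements also hold with "semisymmetric" replaced throughout by "totally symmetric".
   Context: A Latin square of order $n$ is a set of $n^2$ triples (row, column, symbol) over $\{1,\dots,n\}$, distinct triples agreeing in at most one coordinate. It is semisymmetric if whenever $(a,b,c)$ is a triple so is $(b,c,a)$; totally symmetric if it is unchanged by every uniform permutation of the triple coordinates; reduced if its first row and column are $1,\dots,n$ in order; unipotent if all main diagonal entries are equal. An isotopism $(\alpha,\beta,\gamma)\in\mathcal{S}_n^3$ maps $(r,c,s)$ to $(r^\alpha,c^\beta,s^\gamma)$; an isomorphism has $\alpha=\beta=\gamma$. A paratopism is an isotopism combined with a uniform permutation of the triple coordinates; species are paratopism classes. A class "containing" squares with a property means one containing at least one such square. -}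

module Defs where

open import Data.Nat using (ℕ; zero; suc; _*_)
open import Data.Fin using (Fin; toℕ)
open import Data.Fin.Permutation using (Permutation′; _⟨$⟩ʳ_)
open import Data.Product using (Σ; ∃; ∃-syntax; _×_; _,_)
open import Function.Definitions using (Injective)
open import Function.Bundles using (_⇔_)
open import Relation.Binary.PropositionalEquality using (_≡_)

-- A Latin square is a set of n² triples (row, column, symbol) with any
-- two distinct triples agreeing in at most one coordinate.  Equivalently
-- (and this is how we represent it) it is the graph of a function
-- cell : Fin n → Fin n → Fin n (row & column determine the symbol) such
-- that row and symbol determine the column (rowInj) and column and
-- symbol determine the row (colInj).  Symbols {1..n} are Fin n, with
-- 1 ↦ Fin.zero.

record LatinSquare (n : ℕ) : Set where
  field
    cell   : Fin n → Fin n → Fin n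
    rowInj : ∀ r → Injective _≡_ _≡_ (cell r)
    colInj : ∀ c → Injective _≡_ _≡_ (λ r → cell r c)
open LatinSquare public

Triple : ℕ → Set
Triple n = Fin n × Fin n × Fin n

_∈L_ : ∀ {n} → Triple n → LatinSquare n → Set
(r , c , s) ∈L L = cell L r c ≡ s

data S₃ : Set where
  id₃ c₁ c₂ t₁₂ t₁₃ t₂₃ : S₃

act : ∀ {n} → S₃ → Triple n → Triple n
act id₃ (a , b , c) = (a , b , c)
act c₁  (a , b , c) = (b , c , a)
act c₂  (a , b , c) = (c , a , b)
act t₁₂ (a , b , c) = (b , a , c)
act t₁₃ (a , b , c) = (c , b , a)
act t₂₃ (a , b , c) = (a , c , b)

Semisymmetric : ∀ {n} → LatinSquare n → Set
Semisymmetric L = ∀ a b c → (a , b , c) ∈L L → (b , c , a) ∈L L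

TotallySymmetric : ∀ {n} → LatinSquare n → Set
TotallySymmetric L = ∀ σ t → t ∈L L → act σ t ∈L L

Reduced : ∀ {n} → LatinSquare n → Set
Reduced {n} L = ∀ (z : Fin n) → toℕ z ≡ 0 →
  (∀ j → cell L z j ≡ j) × (∀ i → cell L i z ≡ i)

Unipotent : ∀ {n} → LatinSquare n → Set
Unipotent L = ∀ i j → cell L i i ≡ cell L j j

isot : ∀ {n} → Permutation′ n → Permutation′ n → Permutation′ n → Triple n → Triple n
isot α β γ (r , c , s) = (α ⟨$⟩ʳ r , β ⟨$⟩ʳ c , γ ⟨$⟩ʳ s)

Isotopic : ∀ {n} → LatinSquare n → LatinSquare n → Set
Isotopic {n} L₁ L₂ = ∃[ α ] ∃[ β ] ∃[ γ ]
  (∀ (t : Triple n) → (t ∈L L₁) ⇔ (isot α β γ t ∈L L₂))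

Isomorphic : ∀ {n} → LatinSquare n → LatinSquare n → Set
Isomorphic {n} L₁ L₂ = ∃[ α ]
  (∀ (t : Triple n) → (t ∈L L₁) ⇔ (isot α α α t ∈L L₂))

Paratopic : ∀ {n} → LatinSquare n → LatinSquare n → Set
Paratopic {n} L₁ L₂ = ∃[ σ ] ∃[ α ] ∃[ β ] ∃[ γ ]
  (∀ (t : Triple n) → (t ∈L L₁) ⇔ (isot α β γ (act σ t) ∈L L₂))

SameSquare : ∀ {n} → LatinSquare n → LatinSquare n → Set
SameSquare L₁ L₂ = ∀ r c → cell L₁ r c ≡ cell L₂ r c

-- NumClasses R P k : "the number of R-equivalence classes containing an
-- element satisfying P is k", witnessed by a system of k pairwise
-- R-inequivalent representatives satisfying P such that every element
-- satisfying P is R-equivalent to one of them.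
-- With R = SameSquare this says "there are exactly k squares satisfying P".

NumClasses : {A : Set} → (A → A → Set) → (A → Set) → ℕ → Set
NumClasses {A} R P k = Σ (Fin k → A) λ f →
    (∀ i → P (f i))
  × (∀ i j → R (f i) (f j) → i ≡ j)
  × (∀ x → P x → ∃[ i ] R x (f i))

UnipSym RedSym : (Sym : ∀ {n} → LatinSquare n → Set) → ∀ {n} → LatinSquare n → Set
UnipSym Sym L = Unipotent L × Sym L
RedSym  Sym L = Reduced L × Sym L

Lemma10For : (Sym : ∀ {n} → LatinSquare n → Set) → Set
Lemma10For Sym = ∀ (n : ℕ) → 1 Data.Nat.≤ n →
    (∀ a b → NumClasses SameSquare (UnipSym Sym {n}) a
           → NumClasses SameSquare (RedSym Sym {n}) b → a ≡ n * b)
  × (∀ a b → NumClasses Isomorphic (UnipSym Sym {n}) a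
           → NumClasses Isomorphic (RedSym Sym {n}) b → a ≡ b)
  × (∀ a b → NumClasses Isotopic (UnipSym Sym {n}) a
           → NumClasses Isotopic (RedSym Sym {n}) b → a ≡ b)
  × (∀ a b → NumClasses Paratopic (UnipSym Sym {n}) a
           → NumClasses Paratopic (RedSym Sym {n}) b → a ≡ b)
  where import Data.Nat

-- A unipotent semisymmetric square L with diagonal symbol e has e as a
-- two-sided identity: (j, j, e) ∈ L rotates to (j, e, j) and then to
-- (e, j, j).  Hence relabelling the symbols by any permutation sending e to
-- the first symbol gives a reduced square, and conversely a reduced
-- semisymmetric square is unipotent with diagonal symbol 1.  So the
-- unipotent squares are exactly the relabellings (1 e) · R of the reduced
-- squares R, one for each diagonal symbol e, and every unipotent square is
-- isomorphic to a reduced one.  A relabelling commutes with permuting the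
-- coordinates of triples, so it preserves semisymmetry and total symmetry.
module Submission where

open import Defs
open import Data.Fin using (Fin; zero; suc)
open import Data.Fin.Permutation
  using (Permutation′; _⟨$⟩ʳ_; _⟨$⟩ˡ_; inverseˡ; inverseʳ; flip; _∘ₚ_; transpose)
open import Data.Fin.Properties using (injective⇒≤; *↔×)
open import Data.Nat using (ℕ; zero; suc; _*_; _≤_)
open import Data.Nat.Properties using (≤-antisym)
open import Data.Product using (_×_; _,_; proj₁; proj₂; ∃-syntax)
open import Function using (_∘_; id; _↔_; Inverse; Injection; _⇔_; mk⇔; Equivalence)
open import Function.Definitions using (Injective)
open import Function.Properties.Equivalence using () renaming (sym to ⇔-sym; trans to ⇔-trans)
open import Function.Properties.Inverse using (↔⇒↣)
open import Relation.Binary.PropositionalEquality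
open ≡-Reasoning

module _ {A : Set} {R : A → A → Set} {P : A → Set} where

  numClasses-≤ : (∀ x y → R x y → R y x) → (∀ x y z → R x y → R y z → R x z) →
                 ∀ {a b} → NumClasses R P a → NumClasses R P b → a ≤ b
  numClasses-≤ R-sym R-trans {a} {b} (f , Pf , f-distinct , _) (g , _ , _ , g-covers) =
    injective⇒≤ classOf-injective
    where
    classOf : Fin a → Fin b
    classOf i = proj₁ (g-covers (f i) (Pf i))

    covered : ∀ i → R (f i) (g (classOf i))
    covered i = proj₂ (g-covers (f i) (Pf i))

    classOf-injective : Injective _≡_ _≡_ classOf
    classOf-injective {i} {j} eq =
      f-distinct i j (R-trans _ _ _ (covered i) (R-sym _ _ (subst (R (f j) ∘ g) (sym eq) (covered j))))

  numClasses-unique : (∀ x y → R x y → R y x) → (∀ x y z → R x y → R y z → R x z) →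
                      ∀ {a b} → NumClasses R P a → NumClasses R P b → a ≡ b
  numClasses-unique R-sym R-trans sa sb =
    ≤-antisym (numClasses-≤ R-sym R-trans sa sb) (numClasses-≤ R-sym R-trans sb sa)

  numClasses-↔ : ∀ {k} {I : Set} → Fin k ↔ I → (f : I → A) → (∀ i → P (f i)) →
                 (∀ i j → R (f i) (f j) → i ≡ j) → (∀ x → P x → ∃[ i ] R x (f i)) →
                 NumClasses R P k
  numClasses-↔ e f Pf f-distinct f-covers =
      f ∘ to
    , Pf ∘ to
    , (λ i j r → Injection.injective (↔⇒↣ e) (f-distinct (to i) (to j) r))
    , λ x Px → let (i , r) = f-covers x Px in
               from i , subst (R x ∘ f) (sym (strictlyInverseˡ i)) r
    where open Inverse e

  numClasses-extend : (∀ x y z → R x y → R y z → R x z) → ∀ {Q : A → Set} {b} →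
                      (∀ {x} → Q x → P x) → (∀ x → P x → ∃[ y ] Q y × R x y) →
                      NumClasses R Q b → NumClasses R P b
  numClasses-extend R-trans Q⇒P reduce (g , Qg , g-distinct , g-covers) =
      g
    , Q⇒P ∘ Qg
    , g-distinct
    , λ x Px → let (y , Qy , x~y) = reduce x Px ; (i , y~gi) = g-covers y Qy in
               i , R-trans _ _ _ x~y y~gi

module _ {n : ℕ} where

  same-sym : ∀ L₁ L₂ → SameSquare {n} L₁ L₂ → SameSquare L₂ L₁
  same-sym _ _ s r c = sym (s r c)

  same-trans : ∀ L₁ L₂ L₃ → SameSquare {n} L₁ L₂ → SameSquare L₂ L₃ → SameSquare L₁ L₃
  same-trans _ _ _ s s′ r c = trans (s r c) (s′ r c)

  Transports : (Triple n → Triple n) → LatinSquare n → LatinSquare n → Set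
  Transports θ L₁ L₂ = ∀ t → (t ∈L L₁) ⇔ (θ t ∈L L₂)

  ∈-resp-≡ : ∀ {L : LatinSquare n} {t u} → t ≡ u → (t ∈L L) ⇔ (u ∈L L)
  ∈-resp-≡ refl = mk⇔ id id

  transports-inverse : ∀ {L₁ L₂} θ θ′ → (∀ u → θ (θ′ u) ≡ u) →
                       Transports θ L₁ L₂ → Transports θ′ L₂ L₁
  transports-inverse {L₂ = L₂} θ θ′ θθ′ h u =
    ⇔-trans (∈-resp-≡ {L = L₂} (sym (θθ′ u))) (⇔-sym (h _))

  transports-∘ : ∀ {L₁ L₂ L₃} θ₁ θ₂ θ → (∀ t → θ₂ (θ₁ t) ≡ θ t) →
                 Transports θ₁ L₁ L₂ → Transports θ₂ L₂ L₃ → Transports θ L₁ L₃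
  transports-∘ {L₃ = L₃} θ₁ θ₂ θ θ₂θ₁ h h′ t =
    ⇔-trans (h t) (⇔-trans (h′ _) (∈-resp-≡ {L = L₃} (θ₂θ₁ t)))

Isotopism : ℕ → Set
Isotopism n = Permutation′ n × Permutation′ n × Permutation′ n

module _ {n : ℕ} where

  isotopism : Isotopism n → Triple n → Triple n
  isotopism (α , β , γ) = isot α β γ

  invert : Isotopism n → Isotopism n
  invert (α , β , γ) = flip α , flip β , flip γ

  infixr 9 _⨾_
  _⨾_ : Isotopism n → Isotopism n → Isotopism n
  (α , β , γ) ⨾ (α′ , β′ , γ′) = α ∘ₚ α′ , β ∘ₚ β′ , γ ∘ₚ γ′

  reorder : S₃ → Isotopism n → Isotopism n
  reorder id₃ (α , β , γ) = α , β , γ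
  reorder c₁  (α , β , γ) = β , γ , α
  reorder c₂  (α , β , γ) = γ , α , β
  reorder t₁₂ (α , β , γ) = β , α , γ
  reorder t₁₃ (α , β , γ) = γ , β , α
  reorder t₂₃ (α , β , γ) = α , γ , β

  isotopism-invert : ∀ x u → isotopism x (isotopism (invert x) u) ≡ u
  isotopism-invert (α , β , γ) (a , b , c) =
    cong₂ _,_ (inverseʳ α) (cong₂ _,_ (inverseʳ β) (inverseʳ γ))

  isotopism-⨾ : ∀ x y t → isotopism y (isotopism x t) ≡ isotopism (x ⨾ y) t
  isotopism-⨾ x y t = refl

  act-isotopism : ∀ σ x t → act σ (isotopism x t) ≡ isotopism (reorder σ x) (act σ t)
  act-isotopism id₃ x t = refl
  act-isotopism c₁  x t = refl
  act-isotopism c₂  x t = refl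
  act-isotopism t₁₂ x t = refl
  act-isotopism t₁₃ x t = refl
  act-isotopism t₂₃ x t = refl

infix 10 _⁻¹
_⁻¹ : S₃ → S₃
id₃ ⁻¹ = id₃
c₁  ⁻¹ = c₂
c₂  ⁻¹ = c₁
t₁₂ ⁻¹ = t₁₂
t₁₃ ⁻¹ = t₁₃
t₂₃ ⁻¹ = t₂₃

c₁· t₁₂· : S₃ → S₃
c₁· id₃ = c₁
c₁· c₁  = c₂
c₁· c₂  = id₃
c₁· t₁₂ = t₂₃
c₁· t₁₃ = t₁₂
c₁· t₂₃ = t₁₃
t₁₂· id₃ = t₁₂
t₁₂· c₁  = t₁₃
t₁₂· c₂  = t₂₃
t₁₂· t₁₂ = id₃
t₁₂· t₁₃ = c₁
t₁₂· t₂₃ = c₂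

-- S₃ is generated by c₁ and t₁₂: c₂ = c₁c₁, t₁₃ = t₁₂c₁ and t₂₃ = c₁t₁₂.
infixl 7 _·_
_·_ : S₃ → S₃ → S₃
id₃ · σ = σ
c₁  · σ = c₁· σ
c₂  · σ = c₁· (c₁· σ)
t₁₂ · σ = t₁₂· σ
t₁₃ · σ = t₁₂· (c₁· σ)
t₂₃ · σ = c₁· (t₁₂· σ)

module _ {n : ℕ} where

  act-⁻¹ : ∀ σ (t : Triple n) → act σ (act (σ ⁻¹) t) ≡ t
  act-⁻¹ id₃ t = refl
  act-⁻¹ c₁  t = refl
  act-⁻¹ c₂  t = refl
  act-⁻¹ t₁₂ t = refl
  act-⁻¹ t₁₃ t = refl
  act-⁻¹ t₂₃ t = refl

  act-c₁· : ∀ σ (t : Triple n) → act c₁ (act σ t) ≡ act (c₁· σ) t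
  act-c₁· id₃ t = refl
  act-c₁· c₁  t = refl
  act-c₁· c₂  t = refl
  act-c₁· t₁₂ t = refl
  act-c₁· t₁₃ t = refl
  act-c₁· t₂₃ t = refl

  act-t₁₂· : ∀ σ (t : Triple n) → act t₁₂ (act σ t) ≡ act (t₁₂· σ) t
  act-t₁₂· id₃ t = refl
  act-t₁₂· c₁  t = refl
  act-t₁₂· c₂  t = refl
  act-t₁₂· t₁₂ t = refl
  act-t₁₂· t₁₃ t = refl
  act-t₁₂· t₂₃ t = refl

  act-· : ∀ τ σ (t : Triple n) → act τ (act σ t) ≡ act (τ · σ) t
  act-· id₃ σ t = refl
  act-· c₁  σ t = act-c₁· σ t
  act-· c₂  σ t = trans (cong (act c₁) (act-c₁· σ t)) (act-c₁· (c₁· σ) t)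
  act-· t₁₂ σ t = act-t₁₂· σ t
  act-· t₁₃ σ t = trans (cong (act t₁₂) (act-c₁· σ t)) (act-t₁₂· (c₁· σ) t)
  act-· t₂₃ σ t = trans (cong (act c₁) (act-t₁₂· σ t)) (act-c₁· (t₁₂· σ) t)

module _ {n : ℕ} where

  transports-invert : ∀ x (L₁ L₂ : LatinSquare n) →
                      Transports (isotopism x) L₁ L₂ → Transports (isotopism (invert x)) L₂ L₁
  transports-invert x L₁ L₂ =
    transports-inverse {L₁ = L₁} {L₂ = L₂} (isotopism x) (isotopism (invert x)) (isotopism-invert x)

  transports-⨾ : ∀ x y (L₁ L₂ L₃ : LatinSquare n) → Transports (isotopism x) L₁ L₂ →
                 Transports (isotopism y) L₂ L₃ → Transports (isotopism (x ⨾ y)) L₁ L₃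
  transports-⨾ x y L₁ L₂ L₃ =
    transports-∘ {L₁ = L₁} {L₂ = L₂} {L₃ = L₃}
      (isotopism x) (isotopism y) (isotopism (x ⨾ y)) (isotopism-⨾ x y)

  paratopic : ∀ σ x (L₁ L₂ : LatinSquare n) →
              Transports (isotopism x ∘ act σ) L₁ L₂ → Paratopic L₁ L₂
  paratopic σ (α , β , γ) _ _ h = σ , α , β , γ , h

  isomorphic-sym : ∀ L₁ L₂ → Isomorphic {n} L₁ L₂ → Isomorphic L₂ L₁
  isomorphic-sym L₁ L₂ (α , h) = flip α , transports-invert (α , α , α) L₁ L₂ h

  isomorphic-trans : ∀ L₁ L₂ L₃ → Isomorphic {n} L₁ L₂ → Isomorphic L₂ L₃ → Isomorphic L₁ L₃
  isomorphic-trans L₁ L₂ L₃ (α , h) (α′ , h′) =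
    α ∘ₚ α′ , transports-⨾ (α , α , α) (α′ , α′ , α′) L₁ L₂ L₃ h h′

  isotopic-sym : ∀ L₁ L₂ → Isotopic {n} L₁ L₂ → Isotopic L₂ L₁
  isotopic-sym L₁ L₂ (α , β , γ , h) =
    flip α , flip β , flip γ , transports-invert (α , β , γ) L₁ L₂ h

  isotopic-trans : ∀ L₁ L₂ L₃ → Isotopic {n} L₁ L₂ → Isotopic L₂ L₃ → Isotopic L₁ L₃
  isotopic-trans L₁ L₂ L₃ (α , β , γ , h) (α′ , β′ , γ′ , h′) =
    α ∘ₚ α′ , β ∘ₚ β′ , γ ∘ₚ γ′ , transports-⨾ (α , β , γ) (α′ , β′ , γ′) L₁ L₂ L₃ h h′

  paratopic-sym : ∀ L₁ L₂ → Paratopic {n} L₁ L₂ → Paratopic L₂ L₁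
  paratopic-sym L₁ L₂ (σ , α , β , γ , h) =
    paratopic (σ ⁻¹) x′ L₂ L₁
      (transports-inverse {L₁ = L₁} {L₂ = L₂}
         (isotopism x ∘ act σ) (isotopism x′ ∘ act (σ ⁻¹)) inverse-law h)
    where
    x = (α , β , γ)
    x′ = reorder (σ ⁻¹) (invert x)
    inverse-law : ∀ u → isotopism x (act σ (isotopism x′ (act (σ ⁻¹) u))) ≡ u
    inverse-law u = begin
      isotopism x (act σ (isotopism x′ (act (σ ⁻¹) u)))
        ≡⟨ cong (isotopism x ∘ act σ) (sym (act-isotopism (σ ⁻¹) (invert x) u)) ⟩
      isotopism x (act σ (act (σ ⁻¹) (isotopism (invert x) u)))
        ≡⟨ cong (isotopism x) (act-⁻¹ σ _) ⟩
      isotopism x (isotopism (invert x) u)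
        ≡⟨ isotopism-invert x u ⟩
      u ∎

  paratopic-trans : ∀ L₁ L₂ L₃ → Paratopic {n} L₁ L₂ → Paratopic L₂ L₃ → Paratopic L₁ L₃
  paratopic-trans L₁ L₂ L₃ (σ , α , β , γ , h) (τ , α′ , β′ , γ′ , h′) =
    paratopic (τ · σ) z L₁ L₃
      (transports-∘ {L₁ = L₁} {L₂ = L₂} {L₃ = L₃} (isotopism x ∘ act σ) (isotopism y ∘ act τ)
                    (isotopism z ∘ act (τ · σ)) composition-law h h′)
    where
    x = (α , β , γ)
    y = (α′ , β′ , γ′)
    z = reorder τ x ⨾ y
    composition-law : ∀ t → isotopism y (act τ (isotopism x (act σ t))) ≡ isotopism z (act (τ · σ) t)
    composition-law t = begin
      isotopism y (act τ (isotopism x (act σ t)))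
        ≡⟨ cong (isotopism y) (act-isotopism τ x (act σ t)) ⟩
      isotopism y (isotopism (reorder τ x) (act τ (act σ t)))
        ≡⟨ isotopism-⨾ (reorder τ x) y _ ⟩
      isotopism z (act τ (act σ t))
        ≡⟨ cong (isotopism z) (act-· τ σ t) ⟩
      isotopism z (act (τ · σ) t) ∎

  isomorphic⇒isotopic : ∀ (L₁ L₂ : LatinSquare n) → Isomorphic L₁ L₂ → Isotopic L₁ L₂
  isomorphic⇒isotopic _ _ (α , h) = α , α , α , h

  isomorphic⇒paratopic : ∀ (L₁ L₂ : LatinSquare n) → Isomorphic L₁ L₂ → Paratopic L₁ L₂
  isomorphic⇒paratopic _ _ (α , h) = id₃ , α , α , α , h

module _ {n : ℕ} where

  permutation-injective : (π : Permutation′ n) → Injective _≡_ _≡_ (π ⟨$⟩ʳ_)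
  permutation-injective π = Injection.injective (↔⇒↣ π)

  relabel : Permutation′ n → LatinSquare n → LatinSquare n
  cell (relabel π L) r c = π ⟨$⟩ʳ cell L (π ⟨$⟩ˡ r) (π ⟨$⟩ˡ c)
  rowInj (relabel π L) r eq =
    permutation-injective (flip π) (rowInj L (π ⟨$⟩ˡ r) (permutation-injective π eq))
  colInj (relabel π L) c eq =
    permutation-injective (flip π) (colInj L (π ⟨$⟩ˡ c) (permutation-injective π eq))

  relabel-transports : ∀ π L → Transports (isotopism (π , π , π)) L (relabel π L)
  relabel-transports π L (r , c , s) = mk⇔
    (λ eq → cong (π ⟨$⟩ʳ_) (trans (cong₂ (cell L) (inverseˡ π) (inverseˡ π)) eq))
    (λ eq → trans (cong₂ (cell L) (sym (inverseˡ π)) (sym (inverseˡ π)))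
                  (permutation-injective π eq))

  relabel-isomorphic : ∀ π L → Isomorphic L (relabel π L)
  relabel-isomorphic π L = π , relabel-transports π L

  act-isomorphism : ∀ σ (π : Permutation′ n) t → act σ (isot π π π t) ≡ isot π π π (act σ t)
  act-isomorphism id₃ π t = refl
  act-isomorphism c₁  π t = refl
  act-isomorphism c₂  π t = refl
  act-isomorphism t₁₂ π t = refl
  act-isomorphism t₁₃ π t = refl
  act-isomorphism t₂₃ π t = refl

  relabel-closed : ∀ σ π (L : LatinSquare n) → (∀ t → t ∈L L → act σ t ∈L L) →
                   ∀ t → t ∈L relabel π L → act σ t ∈L relabel π L
  relabel-closed σ π L closed t t∈ =
    Equivalence.from (back (act σ t))
      (subst (_∈L L) (act-isomorphism σ (flip π) t) (closed _ (Equivalence.to (back t) t∈)))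
    where
    back : Transports (isotopism (invert (π , π , π))) (relabel π L) L
    back = transports-invert (π , π , π) L (relabel π L) (relabel-transports π L)

  relabel-semisymmetric : ∀ π (L : LatinSquare n) → Semisymmetric L → Semisymmetric (relabel π L)
  relabel-semisymmetric π L ss a b c = relabel-closed c₁ π L (λ (a , b , c) → ss a b c) (a , b , c)

  relabel-totallySymmetric : ∀ π (L : LatinSquare n) →
                             TotallySymmetric L → TotallySymmetric (relabel π L)
  relabel-totallySymmetric π L ts σ = relabel-closed σ π L (ts σ)

  relabel-unipotent : ∀ π (L : LatinSquare n) → Unipotent L → Unipotent (relabel π L)
  relabel-unipotent π L u i j = cong (π ⟨$⟩ʳ_) (u _ _)

  relabel-diagonal : ∀ π (L : LatinSquare n) → Unipotent L →
                     ∀ i k → cell (relabel π L) i i ≡ π ⟨$⟩ʳ cell L k k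
  relabel-diagonal π L u i k = cong (π ⟨$⟩ʳ_) (u _ k)

  relabel-cong : ∀ π (L M : LatinSquare n) → SameSquare L M → SameSquare (relabel π L) (relabel π M)
  relabel-cong π L M s r c = cong (π ⟨$⟩ʳ_) (s _ _)

  relabel-cancel : ∀ π (L M : LatinSquare n) →
                   SameSquare (relabel π L) (relabel π M) → SameSquare L M
  relabel-cancel π L M s r c = begin
    cell L r c                                  ≡⟨ cong₂ (cell L) (inverseˡ π) (inverseˡ π) ⟨
    cell L (π ⟨$⟩ˡ (π ⟨$⟩ʳ r)) (π ⟨$⟩ˡ (π ⟨$⟩ʳ c)) ≡⟨ permutation-injective π (s _ _) ⟩
    cell M (π ⟨$⟩ˡ (π ⟨$⟩ʳ r)) (π ⟨$⟩ˡ (π ⟨$⟩ʳ c)) ≡⟨ cong₂ (cell M) (inverseˡ π) (inverseˡ π) ⟩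
    cell M r c                                  ∎

  relabel-flip : ∀ π (L : LatinSquare n) → SameSquare (relabel π (relabel (flip π) L)) L
  relabel-flip π L r c = trans (inverseʳ π) (cong₂ (cell L) (inverseʳ π) (inverseʳ π))

module _ {n : ℕ} (L : LatinSquare n) (ss : Semisymmetric L) where

  unipotent⇒diagonal-identity : Unipotent L → ∀ k j →
                                cell L (cell L k k) j ≡ j × cell L j (cell L k k) ≡ j
  unipotent⇒diagonal-identity u k j = ss j (cell L k k) j right-identity , right-identity
    where
    right-identity : cell L j (cell L k k) ≡ j
    right-identity = ss j j (cell L k k) (u j k)

module _ {m : ℕ} (L : LatinSquare (suc m)) (ss : Semisymmetric L) where

  reduced⇒diagonal-zero : Reduced L → ∀ i → cell L i i ≡ zero
  reduced⇒diagonal-zero red i = ss zero i i (proj₁ (red zero refl) i)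

  reduced⇒unipotent : Reduced L → Unipotent L
  reduced⇒unipotent red i j = trans (reduced⇒diagonal-zero red i) (sym (reduced⇒diagonal-zero red j))

  unipotent⇒reduced : Unipotent L → cell L zero zero ≡ zero → Reduced L
  unipotent⇒reduced u d≡0 zero    _ =
      (λ j → subst (λ e → cell L e j ≡ j) d≡0 (proj₁ (identity j)))
    , (λ i → subst (λ e → cell L i e ≡ i) d≡0 (proj₂ (identity i)))
    where identity = unipotent⇒diagonal-identity L ss u zero
  unipotent⇒reduced u d≡0 (suc _) ()

module Lemma10
  (Sym : ∀ {n} → LatinSquare n → Set)
  (sym⇒semisymmetric : ∀ {n} (L : LatinSquare n) → Sym L → Semisymmetric L)
  (relabel-sym : ∀ {n} (π : Permutation′ n) (L : LatinSquare n) → Sym L → Sym (relabel π L))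
  where

  module _ {m : ℕ} where

    redSym-diagonal : ∀ (L : LatinSquare (suc m)) → RedSym Sym L → ∀ i → cell L i i ≡ zero
    redSym-diagonal L (red , s) = reduced⇒diagonal-zero L (sym⇒semisymmetric L s) red

    redSym⇒unipSym : ∀ (L : LatinSquare (suc m)) → RedSym Sym L → UnipSym Sym L
    redSym⇒unipSym L (red , s) = reduced⇒unipotent L (sym⇒semisymmetric L s) red , s

    relabel-unipSym : ∀ π (L : LatinSquare (suc m)) → UnipSym Sym L → UnipSym Sym (relabel π L)
    relabel-unipSym π L (u , s) = relabel-unipotent π L u , relabel-sym π L s

    -- transpose zero e sends zero to e, so its inverse sends the diagonal symbol to zero.
    reduce : LatinSquare (suc m) → LatinSquare (suc m)
    reduce L = relabel (flip (transpose zero (cell L zero zero))) L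

    reduce-isomorphic : ∀ L → Isomorphic L (reduce L)
    reduce-isomorphic L = relabel-isomorphic (flip (transpose zero (cell L zero zero))) L

    reduce-reduced : ∀ (L : LatinSquare (suc m)) → UnipSym Sym L → RedSym Sym (reduce L)
    reduce-reduced L (u , s) =
      unipotent⇒reduced (reduce L) (sym⇒semisymmetric _ s′) (relabel-unipotent π L u)
        (trans (relabel-diagonal π L u zero zero) (inverseˡ τ)) , s′
      where
      τ = transpose zero (cell L zero zero)
      π = flip τ
      s′ = relabel-sym π L s

    unipotent-copies : ∀ {b} → NumClasses SameSquare (RedSym Sym) b →
                       NumClasses SameSquare (UnipSym Sym) (suc m * b)
    unipotent-copies {b} (g , g-red , g-distinct , g-covers) =
      numClasses-↔ {R = SameSquare} {P = UnipSym Sym} *↔× copy copy-unip copy-distinct copy-covers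
      where
      copy : Fin (suc m) × Fin b → LatinSquare (suc m)
      copy (e , i) = relabel (transpose zero e) (g i)

      g-unip : ∀ i → UnipSym Sym (g i)
      g-unip i = redSym⇒unipSym (g i) (g-red i)

      copy-unip : ∀ p → UnipSym Sym (copy p)
      copy-unip (e , i) = relabel-unipSym (transpose zero e) (g i) (g-unip i)

      copy-diagonal : ∀ e i x → cell (copy (e , i)) x x ≡ e
      copy-diagonal e i x =
        trans (relabel-diagonal (transpose zero e) (g i) (proj₁ (g-unip i)) x zero)
              (cong (transpose zero e ⟨$⟩ʳ_) (redSym-diagonal (g i) (g-red i) zero))

      copy-distinct : ∀ p q → SameSquare (copy p) (copy q) → p ≡ q
      copy-distinct (e , i) (e′ , i′) same
        with refl ← trans (sym (copy-diagonal e i e)) (trans (same e e) (copy-diagonal e′ i′ e))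
        = cong (e ,_) (g-distinct i i′ (relabel-cancel (transpose zero e) (g i) (g i′) same))

      copy-covers : ∀ x → UnipSym Sym x → ∃[ p ] SameSquare x (copy p)
      copy-covers x ux with (i , same) ← g-covers (reduce x) (reduce-reduced x ux) =
        (d , i) , λ r c → trans (sym (relabel-flip τ x r c)) (relabel-cong τ (reduce x) (g i) same r c)
        where
        d = cell x zero zero
        τ = transpose zero d

    squares-count : ∀ a b → NumClasses SameSquare (UnipSym Sym) a →
                    NumClasses SameSquare (RedSym Sym) b → a ≡ suc m * b
    squares-count a b unip red =
      numClasses-unique {R = SameSquare} same-sym same-trans unip (unipotent-copies red)

    classes-agree : {R : LatinSquare (suc m) → LatinSquare (suc m) → Set} →
                    (∀ x y → R x y → R y x) → (∀ x y z → R x y → R y z → R x z) →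
                    (∀ L M → Isomorphic L M → R L M) →
                    ∀ a b → NumClasses R (UnipSym Sym) a → NumClasses R (RedSym Sym) b → a ≡ b
    classes-agree R-sym R-trans isomorphic⇒R a b unip red =
      numClasses-unique R-sym R-trans unip (numClasses-extend {P = UnipSym Sym} R-trans (redSym⇒unipSym _)
        (λ x ux → reduce x , reduce-reduced x ux , isomorphic⇒R x (reduce x) (reduce-isomorphic x)) red)

  lemma10For : Lemma10For Sym
  lemma10For zero ()
  lemma10For (suc m) _ =
      squares-count
    , classes-agree {R = Isomorphic} isomorphic-sym isomorphic-trans (λ _ _ iso → iso)
    , classes-agree {R = Isotopic} isotopic-sym isotopic-trans isomorphic⇒isotopic
    , classes-agree {R = Paratopic} paratopic-sym paratopic-trans isomorphic⇒paratopic

lemma10 : Lemma10For Semisymmetric × Lemma10For TotallySymmetric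
lemma10 =
    Lemma10.lemma10For Semisymmetric (λ _ ss → ss) relabel-semisymmetric
  , Lemma10.lemma10For TotallySymmetric (λ _ ts a b c → ts c₁ (a , b , c)) relabel-totallySymmetric
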